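{- Let $\overline{\mathsf{M}}=\langle I,\{S_\Phi\}_{\Phi\subseteq\mathsf{At}},(r^\Phi_\Psi),(\Lambda_i)_{i\in I},(\Pi_i)_{i\in I},v\rangle$ be a complemented HMS model and $FH(\overline{\mathsf{M}})$ its FH-transform. Then for all $\varphi\in\mathcal{L}_{\mathsf{At}}$ and all $\omega\in S_{\mathsf{At}}$: $\overline{\mathsf{M}},\omega\vDash\varphi$ if and only if $FH(\overline{\mathsf{M}}),\omega\Vdash\varphi$.
   Context: Fix non-empty sets $\mathsf{At}$ (atoms) and $I$ (individuals). Language $\mathcal{L}_{\mathsf{At}}$: $\varphi::=\top\mid p\mid\neg\varphi\mid\varphi\wedge\psi\mid\ell_i\varphi\mid a_i\varphi\mid k_i\varphi$; $\mathsf{At}(\varphi)$ = atoms in $\varphi$; $\mathcal{L}_\Phi=\{\varphi:\mathsf{At}(\varphi)\subseteq\Phi\}$. Complemented HMS model: non-empty pairwise disjoint spaces $S_\Phi$ ($\Phi\subseteq\mathsf{At}$), ordered $S_{\Phi'}\succeq S_\Phi$ iff $\Phi\subseteq\Phi'$; $\Omega=\bigcup_\Phi S_\Phi$; surjections $r^\Phi_\Psi:S_\Phi\to S_\Psi$ ($\Psi\subseteq\Phi$), $r^\Phi_\Phi=\mathrm{id}$, $r^\Phi_\Upsilon=r^\Psi_\Upsilon\circ r^\Phi_\Psi$; $\omega_\Psi=r^\Phi_\Psi(\omega)$, $D_\Psi=D_{S_\Psi}=r^\Phi_\Psi(D)$, $D^\uparrow=\bigcup_{\Phi\subseteq\Psi}(r^\Psi_\Phi)^{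 -1}(D)$ for $D\subseteq S_\Phi$. Events: $E=D^\uparrow$ with base-space $S(E)=S_\Phi$ (vacuous events $\emptyset^{S_\Phi}$ distinguished by base-space); $\neg E=(S(E)\setminus D)^\uparrow$; conjunction = intersection; $v:\mathsf{At}\to$ events. For each $i$: $\Pi_i:\Omega\to2^\Omega\setminus\{\emptyset\}$ with Confinement ($\omega\in S_\Phi\Rightarrow\Pi_i(\omega)\subseteq S_\Psi$ for some $\Psi\subseteq\Phi$, this space denoted $S_{\Pi_i(\omega)}$), Generalized Reflexivity ($\omega\in\Pi_i(\omega)^\uparrow$), Stationarity ($\omega'\in\Pi_i(\omega)\Rightarrow\Pi_i(\omega')=\Pi_i(\omega)$), Projections Preserve Ignorance ($\omega\in S_\Phi$, $\Psi\subseteq\Phi\Rightarrow\Pi_i(\omega)^\uparrow\subseteq\Pi_i(\omega_\Psi)^\uparrow$), Projections Preserve Knowledge ($\Upsilon\subseteq\Psi\subseteq\Phi$, $\omega\in S_\Phi$, $\Pi_i(\omega)\subseteq S_\Psi\Rightarrow\Pi_i(\omega)_\Upsilon=\Pi_i(\omega_\Upsilon)$); and $\Lambda_i:\Omega\to2^\Omega$ with Reflexivity, Stationarity, Projections Preserve Implicit Knowledge ($\omega\in S_\Phi$, $\Psi\subseteq\Phi\Rightarrow\Lambda_i(\omega)_\Psi=\Lambda_i(\omega_\Psi)$), Explicit Measurability ($\omega'\in\Lambda_i(\omega)\Rightarrow\Pi_i(\omega')=\Pi_i(\omega)$), Implicit Measurability ($\omega'\in\Pi_i(\omega)\Rightarrow\Lambda_i(\omega')=\Lambda_i(\omega)_{S_{\Pi_i(\omega)}}$).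 HMS satisfaction: $\top$ always; $p$ iff $\omega\in v(p)$; $\neg\varphi$ iff $\omega\in\neg[\varphi]$; $\varphi\wedge\psi$ iff $\omega\in[\varphi]\cap[\psi]$; $a_i\varphi$ iff $S_{\Pi_i(\omega)}\succeq S([\varphi])$; $\ell_i\varphi$ iff $\Lambda_i(\omega)\subseteq[\varphi]$; $k_i\varphi$ iff $\Pi_i(\omega)\subseteq[\varphi]$; $[\varphi]$ = set of satisfying states. FH-transform $FH(\overline{\mathsf{M}})=\langle I,W_{\mathsf{At}},(R_{\mathsf{At},i}),(\mathcal{A}_{\mathsf{At},i}),V_{\mathsf{At}}\rangle$: $W_{\mathsf{At}}=S_{\mathsf{At}}$; $(\omega,\omega')\in R_{\mathsf{At},i}$ iff $\omega'\in\Lambda_i(\omega)$; $\mathcal{A}_{\mathsf{At},i}(\omega)=\mathcal{L}_\Phi$ where $\Pi_i(\omega)\subseteq S_\Phi$; $V_{\mathsf{At}}(p)=v(p)\cap S_{\mathsf{At}}$. FH satisfaction at $w$: $\top$ always; $p$ iff $w\in V_{\mathsf{At}}(p)$; Boolean usual; $a_i\varphi$ iff $\varphi\in\mathcal{A}_{\mathsf{At},i}(w)$; $\ell_i\varphi$ iff $\varphi$ holds at all $t$ with $(w,t)\in R_{\mathsf{At},i}$; $k_i\varphi$ abbreviates $\ell_i\varphi\wedge a_i\varphi$. -}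

module Defs where

open import Level using (0ℓ; Lift) renaming (suc to lsuc)
open import Data.Product using (Σ; Σ-syntax; ∃; _×_; _,_; proj₁; proj₂)
open import Data.Unit using (⊤)
open import Relation.Nullary using (¬_)
open import Relation.Binary.PropositionalEquality using (_≡_)
open import Relation.Unary using (Pred; _⊆_; _≐_; ｛_｝; U; ∅; _∪_)

1ℓ = lsuc 0ℓ

data Form (At I : Set) : Set where
  ⊤'   : Form At I
  atom : At → Form At I
  ¬'_  : Form At I → Form At I
  _∧'_ : Form At I → Form At I → Form At I
  ℓ    : I → Form At I → Form At I     -- ℓ_i φ  (implicit knowledge)
  aw   : I → Form At I → Form At I
  kn   : I → Form At I → Form At I     -- k_i φ  (explicit knowledge)

Sub : Set → Set₁
Sub At = Pred At 0ℓ

atoms : {At I : Set} → Form At I → Sub At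
atoms ⊤'         = ∅
atoms (atom p)   = ｛ p ｝
atoms (¬' φ)     = atoms φ
atoms (φ ∧' ψ)   = atoms φ ∪ atoms ψ
atoms (ℓ i φ)    = atoms φ
atoms (aw i φ)   = atoms φ
atoms (kn i φ)   = atoms φ

L : {At I : Set} → Sub At → Pred (Form At I) 0ℓ
L Φ φ = atoms φ ⊆ Φ

-- The lattice of spaces S_Φ (Φ ⊆ At) with projections r^Φ_Ψ.
-- Ω = ⋃_Φ S_Φ is the disjoint union Σ Φ, S Φ (so spaces are pairwise disjoint).
-- The proof of Ψ ⊆ Φ is an irrelevant argument of r, so r^Φ_Ψ depends only on Φ, Ψ.

record Spaces (At : Set) : Set₁ where
  field
    S        : Sub At → Set
    S-nonempty : ∀ Φ → S Φ
    r        : ∀ Φ Ψ → .(Ψ ⊆ Φ) → S Φ → S Ψ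
    r-surj   : ∀ Φ Ψ .(p : Ψ ⊆ Φ) (y : S Ψ) → ∃ λ x → r Φ Ψ p x ≡ y
    r-id     : ∀ Φ (x : S Φ) → r Φ Φ (λ z → z) x ≡ x
    r-comp   : ∀ Φ Ψ Υ .(p : Ψ ⊆ Φ) .(q : Υ ⊆ Ψ) (x : S Φ) →
               r Ψ Υ q (r Φ Ψ p x) ≡ r Φ Υ (λ z → p (q z)) x

  Ω : Set₁
  Ω = Σ (Sub At) S

  inSpace : Sub At → Pred Ω 1ℓ
  inSpace Ψ ω = proj₁ ω ≡ Ψ

  proj : (ω : Ω) (Ψ : Sub At) → .(Ψ ⊆ proj₁ ω) → Ω
  proj (Φ , x) Ψ p = Ψ , r Φ Ψ p x

  up : Sub At → Pred Ω 1ℓ → Pred Ω 1ℓ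
  up Ψ D (Φ , x) = Σ (Ψ ⊆ Φ) λ p → D (Ψ , r Φ Ψ p x)

  projSet : Sub At → Pred Ω 1ℓ → Pred Ω 1ℓ
  projSet Ψ D ω' = Σ[ ω ∈ Ω ] (D ω × Σ[ p ∈ Ψ ⊆ proj₁ ω ] (ω' ≡ proj ω Ψ p))

record HMS (At I : Set) : Set₂ where
  field
    sp : Spaces At
  open Spaces sp
  field
    Π           : I → Ω → Pred Ω 1ℓ
    Π-nonempty  : ∀ i ω → ∃ (Π i ω)
    confinement : ∀ i ω → Σ[ Ψ ∈ Sub At ] (Ψ ⊆ proj₁ ω × Π i ω ⊆ inSpace Ψ)
    gen-refl    : ∀ i ω → up (proj₁ (confinement i ω)) (Π i ω) ω
    Π-stat      : ∀ i ω ω' → Π i ω ω' → Π i ω' ≐ Π i ω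
    PPI         : ∀ i ω Ψ (p : Ψ ⊆ proj₁ ω) →
                  up (proj₁ (confinement i ω)) (Π i ω)
                    ⊆ up (proj₁ (confinement i (proj ω Ψ p))) (Π i (proj ω Ψ p))
    PPK         : ∀ i ω Ψ Υ (q : Υ ⊆ Ψ) (p : Ψ ⊆ proj₁ ω) → Π i ω ⊆ inSpace Ψ →
                  projSet Υ (Π i ω) ≐ Π i (proj ω Υ (λ z → p (q z)))
    Λ           : I → Ω → Pred Ω 1ℓ
    Λ-refl      : ∀ i ω → Λ i ω ω
    Λ-stat      : ∀ i ω ω' → Λ i ω ω' → Λ i ω' ≐ Λ i ω
    PPIK        : ∀ i ω Ψ (p : Ψ ⊆ proj₁ ω) → projSet Ψ (Λ i ω) ≐ Λ i (proj ω Ψ p)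
    expl-meas   : ∀ i ω ω' → Λ i ω ω' → Π i ω' ≐ Π i ω
    impl-meas   : ∀ i ω ω' → Π i ω ω' →
                  Λ i ω' ≐ projSet (proj₁ (confinement i ω)) (Λ i ω)
    -- Valuation: v(p) = D_p^↑ with D_p ⊆ S_{{p}} (base-space S_{{p}})
    v           : (p : At) → Pred (S ｛ p ｝) 0ℓ

  ΠSp : I → Ω → Sub At
  ΠSp i ω = proj₁ (confinement i ω)

-- The event [φ] has base-space S_{base φ}, computed by the
-- event algebra: S(v(p)) = S_{{p}}, S(Ω) = S_∅, S(¬E) = S(E), S(E ∩ F) = S(E) ∨ S(F),
-- and the modal events (awareness / implicit / explicit knowledge of E) have base S(E).

module _ {At I : Set} (M : HMS At I) where
  open HMS M
  open Spaces sp

  base : Form At I → Sub At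
  base ⊤'       = ∅
  base (atom p) = ｛ p ｝
  base (¬' φ)   = base φ
  base (φ ∧' ψ) = base φ ∪ base ψ
  base (ℓ i φ)  = base φ
  base (aw i φ) = base φ
  base (kn i φ) = base φ

  _,_⊨_ : Ω → Form At I → Set₁
  _,_⊨_ ω ⊤'             = Lift 1ℓ ⊤
  _,_⊨_ (Φ , x) (atom p) = Lift 1ℓ (Σ (｛ p ｝ ⊆ Φ) λ q → v p (r Φ ｛ p ｝ q x))
  _,_⊨_ (Φ , x) (¬' φ)   = Σ (base φ ⊆ Φ) λ q → ¬ (_,_⊨_ (base φ , r Φ (base φ) q x) φ)
  _,_⊨_ ω (φ ∧' ψ)       = _,_⊨_ ω φ × _,_⊨_ ω ψ
  _,_⊨_ ω (aw i φ)       = Lift 1ℓ (base φ ⊆ ΠSp i ω)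
  _,_⊨_ ω (ℓ i φ)        = Λ i ω ⊆ (λ ω' → _,_⊨_ ω' φ)
  _,_⊨_ ω (kn i φ)       = Π i ω ⊆ (λ ω' → _,_⊨_ ω' φ)

record FHModel (At I : Set) : Set₂ where
  field
    W : Set
    R : I → W → W → Set₁
    A : I → W → Pred (Form At I) 0ℓ
    V : At → Pred W 0ℓ

module _ {At I : Set} (N : FHModel At I) where
  open FHModel N

  _,_⊩_ : W → Form At I → Set₁
  _,_⊩_ w ⊤'       = Lift 1ℓ ⊤
  _,_⊩_ w (atom p) = Lift 1ℓ (V p w)
  _,_⊩_ w (¬' φ)   = ¬ (_,_⊩_ w φ)
  _,_⊩_ w (φ ∧' ψ) = _,_⊩_ w φ × _,_⊩_ w ψ
  _,_⊩_ w (aw i φ) = Lift 1ℓ (A i w φ)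
  _,_⊩_ w (ℓ i φ)  = ∀ t → R i w t → _,_⊩_ t φ
  -- k_i φ abbreviates ℓ_i φ ∧ a_i φ (clauses unfolded)
  _,_⊩_ w (kn i φ) = (∀ t → R i w t → _,_⊩_ t φ) × Lift 1ℓ (A i w φ)

FH : {At I : Set} → HMS At I → FHModel At I
FH {At} {I} M = record
  { W = S U
  ; R = λ i w t → Λ i (U , w) (U , t)
  ; A = λ i w → L (ΠSp i (U , w))
  ; V = λ p w → Σ (｛ p ｝ ⊆ U) λ q → v p (r U ｛ p ｝ q w)
  }
  where
  open HMS M
  open Spaces sp

-- Two facts about HMS models carry the proof. First, the truth of φ at ω is
-- unchanged by projecting ω to any space S_Ψ with At(φ) ⊆ Ψ. Second, given that
-- invariance for φ, k_i φ ↔ ℓ_i φ ∧ a_i φ holds at every state: generalized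
-- reflexivity and explicit measurability turn explicit into implicit knowledge,
-- implicit measurability goes back, and awareness is read off S_{Π_i(ω)}.
-- On S_At every event is defined, so HMS negation is classical negation there,
-- and the clauses of the two semantics then match one by one.
module Submission where

open import Defs
open import Level using (Lift; lift; lower)
open import Data.Product using (Σ; _×_; _,_; <_,_>; proj₁; proj₂)
open import Data.Product.Function.NonDependent.Propositional using (_×-⇔_)
open import Data.Sum using (inj₁; inj₂)
open import Data.Unit using (tt)
open import Function using (_∘_; id)
open import Function.Bundles using (_⇔_; mk⇔; Equivalence)
open import Function.Construct.Identity using (⇔-id)
open import Function.Construct.Composition using (_⇔-∘_)
open import Function.Construct.Symmetry using (⇔-sym)
open import Function.Related.TypeIsomorphisms using (¬-cong-⇔)
open import Relation.Nullary using (¬_)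
open import Relation.Unary using (Pred; U; _⊆_; _∩_; _∪_)
open import Relation.Binary.PropositionalEquality using (_≡_; refl; sym; cong; cong₂; subst)

open Equivalence using (to; from)

≡⇒⊆ : ∀ {a c} {A : Set a} {P Q : Pred A c} → P ≡ Q → P ⊆ Q
≡⇒⊆ refl = id

Lift-⇔ : ∀ {a b c} {A : Set a} {B : Set b} → A ⇔ B → Lift c A ⇔ Lift c B
Lift-⇔ A⇔B = mk⇔ (lift ∘ to A⇔B ∘ lower) (lift ∘ from A⇔B ∘ lower)

base≡atoms : {At I : Set} (M : HMS At I) (φ : Form At I) → base M φ ≡ atoms φ
base≡atoms M ⊤'       = refl
base≡atoms M (atom p) = refl
base≡atoms M (¬' φ)   = base≡atoms M φ
base≡atoms M (φ ∧' ψ) = cong₂ _∪_ (base≡atoms M φ) (base≡atoms M ψ)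
base≡atoms M (ℓ i φ)  = base≡atoms M φ
base≡atoms M (aw i φ) = base≡atoms M φ
base≡atoms M (kn i φ) = base≡atoms M φ

module _ {At : Set} (sp : Spaces At) where
  open Spaces sp

  proj-id : (ω : Ω) → proj ω (proj₁ ω) id ≡ ω
  proj-id (Φ , x) = cong (Φ ,_) (r-id Φ x)

  proj-proj : ∀ (ω : Ω) Ψ Υ .(p : Ψ ⊆ proj₁ ω) .(q : Υ ⊆ Ψ) →
              proj (proj ω Ψ p) Υ q ≡ proj ω Υ (p ∘ q)
  proj-proj (Φ , x) Ψ Υ p q = cong (Υ ,_) (r-comp Φ Ψ Υ p q x)

  ∈-up : ∀ Ψ (D : Pred Ω 1ℓ) {ω : Ω} → proj₁ ω ≡ Ψ → D ω → up Ψ D ω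
  ∈-up Ψ D {.Ψ , x} refl d = id , subst D (sym (proj-id (Ψ , x))) d

  ↑-proj : ∀ {c B Φ Ψ} (D : S B → Set c) (p : Ψ ⊆ Φ) (x : S Φ) → B ⊆ Ψ →
           (Σ (B ⊆ Φ) λ q → D (r Φ B q x)) ⇔ (Σ (B ⊆ Ψ) λ q → D (r Ψ B q (r Φ Ψ p x)))
  ↑-proj {B = B} {Φ} {Ψ} D p x b = mk⇔
    (λ (_ , d) → b , subst D (sym (r-comp Φ Ψ B p b x)) d)
    (λ (q , d) → p ∘ q , subst D (r-comp Φ Ψ B p q x) d)

module _ {At I : Set} (M : HMS At I) where
  open HMS M
  open Spaces sp

  infix 4 _⊨_
  _⊨_ : Ω → Form At I → Set₁
  ω ⊨ φ = _,_⊨_ M ω φ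

  ΠSp⊆space : ∀ i ω → ΠSp i ω ⊆ proj₁ ω
  ΠSp⊆space i ω = proj₁ (proj₂ (confinement i ω))

  Π-space : ∀ i ω {ω'} → Π i ω ω' → proj₁ ω' ≡ ΠSp i ω
  Π-space i ω = proj₂ (proj₂ (confinement i ω))

  Λ-space : ∀ i ω {ω'} → Λ i ω ω' → proj₁ ω' ≡ proj₁ ω
  Λ-space i ω {ω'} l
    with proj₂ (PPIK i ω (proj₁ ω) id) (subst (λ w → Λ i w ω') (sym (proj-id sp ω)) l)
  ... | _ , _ , _ , eq = cong proj₁ eq

  ⊨⇒base⊆ : ∀ φ ω → ω ⊨ φ → base M φ ⊆ proj₁ ω
  ⊨⇒base⊆ ⊤'       ω       _ ()
  ⊨⇒base⊆ (atom p) (Φ , x) (lift (q , _)) = q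
  ⊨⇒base⊆ (¬' φ)   (Φ , x) (q , _) = q
  ⊨⇒base⊆ (φ ∧' ψ) ω (s , _) (inj₁ z) = ⊨⇒base⊆ φ ω s z
  ⊨⇒base⊆ (φ ∧' ψ) ω (_ , t) (inj₂ z) = ⊨⇒base⊆ ψ ω t z
  ⊨⇒base⊆ (ℓ i φ)  ω s = ⊨⇒base⊆ φ ω (s (Λ-refl i ω))
  ⊨⇒base⊆ (aw i φ) ω (lift s) = ΠSp⊆space i ω ∘ s
  ⊨⇒base⊆ (kn i φ) ω s =
    let (e , e∈Π) = Π-nonempty i ω
    in ΠSp⊆space i ω ∘ ≡⇒⊆ (Π-space i ω e∈Π) ∘ ⊨⇒base⊆ φ e (s e∈Π)

  ΠSp-proj⊆ΠSp : ∀ i ω Ψ (p : Ψ ⊆ proj₁ ω) → ΠSp i (proj ω Ψ p) ⊆ ΠSp i ω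
  ΠSp-proj⊆ΠSp i ω Ψ p =
    let (e , e∈Π) = Π-nonempty i ω
        e∈Π↑ = ∈-up sp (ΠSp i ω) (Π i ω) (Π-space i ω e∈Π) e∈Π
    in ≡⇒⊆ (Π-space i ω e∈Π) ∘ proj₁ (PPI i ω Ψ p e∈Π↑)

  ΠSp-proj-below : ∀ i ω Υ (q : Υ ⊆ ΠSp i ω) →
                   ΠSp i (proj ω Υ (ΠSp⊆space i ω ∘ q)) ≡ Υ
  ΠSp-proj-below i ω Υ q =
    let (e , e∈Π) = Π-nonempty i ω
        eΥ∈Π = proj₁ (PPK i ω (ΠSp i ω) Υ q (ΠSp⊆space i ω) (Π-space i ω))
                     (e , e∈Π , ≡⇒⊆ (sym (Π-space i ω e∈Π)) ∘ q , refl)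
    in sym (Π-space i _ eΥ∈Π)

  -- Project first to Υ = ΠSp i ω ∩ Ψ, which lies below both ΠSp i ω and Ψ.
  ΠSp∩⊆ΠSp-proj : ∀ i ω Ψ (p : Ψ ⊆ proj₁ ω) → ΠSp i ω ∩ Ψ ⊆ ΠSp i (proj ω Ψ p)
  ΠSp∩⊆ΠSp-proj i ω Ψ p =
      ΠSp-proj⊆ΠSp i (proj ω Ψ p) (ΠSp i ω ∩ Ψ) proj₂
    ∘ ≡⇒⊆ (cong (ΠSp i) (sym (proj-proj sp ω Ψ (ΠSp i ω ∩ Ψ) p proj₂)))
    ∘ ≡⇒⊆ (sym (ΠSp-proj-below i ω (ΠSp i ω ∩ Ψ) proj₁))

  ProjInvariant : Form At I → Set₁
  ProjInvariant φ = ∀ ω Ψ (p : Ψ ⊆ proj₁ ω) → base M φ ⊆ Ψ → (ω ⊨ φ) ⇔ (proj ω Ψ p ⊨ φ)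

  ℓ-projInvariant : ∀ i φ → ProjInvariant φ → ProjInvariant (ℓ i φ)
  ℓ-projInvariant i φ inv ω Ψ p b = mk⇔ proj⊨ℓ ⊨ℓ
    where
    proj⊨ℓ : ω ⊨ ℓ i φ → proj ω Ψ p ⊨ ℓ i φ
    proj⊨ℓ h l with proj₂ (PPIK i ω Ψ p) l
    ... | ω₁ , l₁ , p₁ , refl = to (inv ω₁ Ψ p₁ b) (h l₁)

    ⊨ℓ : proj ω Ψ p ⊨ ℓ i φ → ω ⊨ ℓ i φ
    ⊨ℓ h {ω₁} l =
      let p₁ : Ψ ⊆ proj₁ ω₁
          p₁ = ≡⇒⊆ (sym (Λ-space i ω l)) ∘ p
      in from (inv ω₁ Ψ p₁ b) (h (proj₁ (PPIK i ω Ψ p) (ω₁ , l , p₁ , refl)))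

  aw-projInvariant : ∀ i φ → ProjInvariant (aw i φ)
  aw-projInvariant i φ ω Ψ p b = mk⇔
    (λ (lift s) → lift (λ z → ΠSp∩⊆ΠSp-proj i ω Ψ p (s z , b z)))
    (λ (lift s) → lift (ΠSp-proj⊆ΠSp i ω Ψ p ∘ s))

  ⊨kn⇔⊨ℓ×⊨aw : ∀ i φ → ProjInvariant φ → ∀ ω →
                (ω ⊨ kn i φ) ⇔ (ω ⊨ ℓ i φ × ω ⊨ aw i φ)
  ⊨kn⇔⊨ℓ×⊨aw i φ inv ω = mk⇔ < ⊨ℓ , ⊨aw > ⊨kn
    where
    ⊨ℓ : ω ⊨ kn i φ → ω ⊨ ℓ i φ
    ⊨ℓ h {t} l =
      let (q , tΠ∈Π) = gen-refl i t
          tΠ⊨φ = h (proj₁ (expl-meas i ω t l) tΠ∈Π)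
      in from (inv t (ΠSp i t) q (⊨⇒base⊆ φ _ tΠ⊨φ)) tΠ⊨φ

    ⊨aw : ω ⊨ kn i φ → ω ⊨ aw i φ
    ⊨aw h =
      let (e , e∈Π) = Π-nonempty i ω
      in lift (≡⇒⊆ (Π-space i ω e∈Π) ∘ ⊨⇒base⊆ φ e (h e∈Π))

    ⊨kn : ω ⊨ ℓ i φ × ω ⊨ aw i φ → ω ⊨ kn i φ
    ⊨kn (h , lift b) {ω'} ω'∈Π with proj₁ (impl-meas i ω ω' ω'∈Π) (Λ-refl i ω')
    ... | ω₁ , l₁ , p₁ , refl = to (inv ω₁ (ΠSp i ω) p₁ b) (h l₁)

  projInvariant : ∀ φ → ProjInvariant φ
  projInvariant ⊤'       ω       Ψ p b = ⇔-id _
  projInvariant (atom a) (Φ , x) Ψ p b = Lift-⇔ (↑-proj sp (v a) p x b)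
  projInvariant (¬' φ)   (Φ , x) Ψ p b =
    ↑-proj sp (λ y → ¬ ((base M φ , y) ⊨ φ)) p x b
  projInvariant (φ ∧' ψ) ω Ψ p b =
    projInvariant φ ω Ψ p (b ∘ inj₁) ×-⇔ projInvariant ψ ω Ψ p (b ∘ inj₂)
  projInvariant (ℓ i φ)  = ℓ-projInvariant i φ (projInvariant φ)
  projInvariant (aw i φ) = aw-projInvariant i φ
  projInvariant (kn i φ) ω Ψ p b =
        ⇔-sym (⊨kn⇔⊨ℓ×⊨aw i φ (projInvariant φ) (proj ω Ψ p))
    ⇔-∘ ((ℓ-projInvariant i φ (projInvariant φ) ω Ψ p b ×-⇔ aw-projInvariant i φ ω Ψ p b)
    ⇔-∘ ⊨kn⇔⊨ℓ×⊨aw i φ (projInvariant φ) ω)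

  ⊨¬⇔¬⊨ : ∀ φ ω → base M φ ⊆ proj₁ ω → (ω ⊨ ¬' φ) ⇔ (¬ ω ⊨ φ)
  ⊨¬⇔¬⊨ φ ω@(Φ , x) b = mk⇔ ⊨¬⇒¬⊨ (λ ¬⊨ → b , ¬⊨ ∘ from (projInvariant φ ω (base M φ) b id))
    where
    ⊨¬⇒¬⊨ : ω ⊨ ¬' φ → ¬ ω ⊨ φ
    ⊨¬⇒¬⊨ (q , ¬⊨) = ¬⊨ ∘ to (projInvariant φ ω (base M φ) q id)

  ⊨ℓ⇔⊩ℓ : ∀ i φ → (∀ y → ((U , y) ⊨ φ) ⇔ (FH M , y ⊩ φ)) →
           ∀ x → ((U , x) ⊨ ℓ i φ) ⇔ (FH M , x ⊩ ℓ i φ)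
  ⊨ℓ⇔⊩ℓ i φ IH x = mk⇔ (λ h t l → to (IH t) (h l)) ⊨ℓ
    where
    ⊨ℓ : FH M , x ⊩ ℓ i φ → (U , x) ⊨ ℓ i φ
    ⊨ℓ h {_ , y} l with Λ-space i (U , x) l
    ... | refl = from (IH y) (h y l)

  ⊨aw⇔⊩aw : ∀ i φ x → ((U , x) ⊨ aw i φ) ⇔ (FH M , x ⊩ aw i φ)
  ⊨aw⇔⊩aw i φ x rewrite base≡atoms M φ = ⇔-id _

  ⊨⇔⊩ : ∀ φ x → ((U , x) ⊨ φ) ⇔ (FH M , x ⊩ φ)
  ⊨⇔⊩ ⊤'       x = ⇔-id _
  ⊨⇔⊩ (atom p) x = ⇔-id _
  ⊨⇔⊩ (¬' φ)   x = ¬-cong-⇔ (⊨⇔⊩ φ x) ⇔-∘ ⊨¬⇔¬⊨ φ (U , x) (λ _ → tt)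
  ⊨⇔⊩ (φ ∧' ψ) x = ⊨⇔⊩ φ x ×-⇔ ⊨⇔⊩ ψ x
  ⊨⇔⊩ (ℓ i φ)  x = ⊨ℓ⇔⊩ℓ i φ (⊨⇔⊩ φ) x
  ⊨⇔⊩ (aw i φ) x = ⊨aw⇔⊩aw i φ x
  ⊨⇔⊩ (kn i φ) x =
    (⊨ℓ⇔⊩ℓ i φ (⊨⇔⊩ φ) x ×-⇔ ⊨aw⇔⊩aw i φ x) ⇔-∘ ⊨kn⇔⊨ℓ×⊨aw i φ (projInvariant φ) (U , x)

proposition11 : {At I : Set} → At → I → (M : HMS At I) →
                (φ : Form At I) (ω : Spaces.S (HMS.sp M) U) →
                (M , (U , ω) ⊨ φ) ⇔ (FH M , ω ⊩ φ)
proposition11 _ _ M = ⊨⇔⊩ M
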